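{- The order of a connected stepwise irregular bicyclic graph is an odd integer. Moreover, for every positive odd integer $n\notin\{1,3,7,11\}$ there exists a connected stepwise irregular bicyclic graph of order $n$.
   Context: All graphs are finite and simple. A graph $G$ is stepwise irregular (SI) if for every edge $uv\in E(G)$ one has $|d_G(u)-d_G(v)|=1$, where $d_G$ denotes degree. The order of a graph is its number of vertices. The cyclomatic number of a connected graph with $n$ vertices and $m$ edges is $\gamma=m-n+1$; a connected graph is bicyclic if $\gamma=2$. -}

module Defs where

open import Data.Nat using (ℕ; zero; suc; _+_; _*_; _<ᵇ_)
open import Data.Bool using (Bool; true; false; _∧_)
open import Data.Fin using (Fin; toℕ)
open import Data.List using (List; allFin; filter; length; map)
open import Data.Nat.ListAction using (sum)
open import Data.Product using (∃; _×_)
open import Data.Sum using (_⊎_)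
open import Relation.Binary.PropositionalEquality using (_≡_)
open import Relation.Nullary.Decidable using (Dec; yes; no)
open import Data.Bool using (T)
open import Data.Bool.Properties using (T?)

record Graph (n : ℕ) : Set where
  field
    adj    : Fin n → Fin n → Bool
    symm   : ∀ i j → adj i j ≡ adj j i
    irrefl : ∀ i → adj i i ≡ false
open Graph public

countFin : (n : ℕ) → (Fin n → Bool) → ℕ
countFin n p = length (filter (λ i → T? (p i)) (allFin n))

degree : ∀ {n} → Graph n → Fin n → ℕ
degree {n} G v = countFin n (adj G v)

numEdges : ∀ {n} → Graph n → ℕ
numEdges {n} G =
  sum (map (λ i → countFin n (λ j → (toℕ i <ᵇ toℕ j) ∧ adj G i j)) (allFin n))

data Walk {n : ℕ} (G : Graph n) : Fin n → Fin n → Set where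
  here : ∀ {u} → Walk G u u
  step : ∀ {u w v} → adj G u w ≡ true → Walk G w v → Walk G u v

Connected : ∀ {n} → Graph n → Set
Connected G = ∀ u v → Walk G u v

StepwiseIrregular : ∀ {n} → Graph n → Set
StepwiseIrregular G = ∀ u v → adj G u v ≡ true →
  (degree G u ≡ suc (degree G v)) ⊎ (degree G v ≡ suc (degree G u))

-- Bicyclic: cyclomatic number m - n + 1 = 2, i.e. m + 1 = n + 2.
-- (Intended to be used together with Connected.)
Bicyclic : ∀ {n} → Graph n → Set
Bicyclic {n} G = numEdges G + 1 ≡ n + 2

Odd : ℕ → Set
Odd n = ∃ λ k → n ≡ suc (2 * k)

module Submission where

-- A weighted handshake lemma says  Σ_{ij ∈ E} (e i + e j) = Σ_i deg(i)·e(i)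
-- for every vertex weight e.  Taking e(i) = 1 if deg(i) is even and 0 otherwise,
-- each edge of an SI graph has exactly one endpoint of even degree, so
-- m = Σ_{deg i even} deg(i) is even; bicyclicity m + 1 = n + 2 then forces n odd.
--
-- A "pendant realisation" is a connected SI bicyclic graph with a
-- leaf whose neighbour has degree 2.  Hanging two pendant paths of length two at
-- that leaf adds four vertices and four edges, keeps the graph SI (the leaf gets
-- degree 3) and creates a new such leaf.  Starting from explicit graphs of orders
-- 9 and 15 this gives all orders 9, 13, 17, ... and 15, 19, 23, ...; order 5 is
-- the complete bipartite graph K₂,₃.

open import Data.Bool using (Bool; true; false; _∧_; _∨_)
open import Data.Bool.ListAction using (any)
open import Data.Bool.Properties using (T?; ∨-comm) renaming (_≟_ to _≟ᵇ_)
open import Data.Empty using (⊥-elim)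
open import Data.Fin using (Fin; zero; suc; toℕ; #_)
open import Data.Fin.Properties using (all?; toℕ-injective) renaming (_≟_ to _≟ᶠ_)
open import Data.List using (List; []; _∷_; filter; length; map; tabulate)
open import Data.List.Properties using (map-tabulate)
open import Data.Maybe using (Maybe; just; nothing; _<∣>_; from-just)
import Data.Maybe as Maybe
open import Data.Nat using (ℕ; zero; suc; _+_; _*_; _<ᵇ_; _≡ᵇ_)
open import Data.Nat.Divisibility using (_∣_; divides; _∣0; ∣m∣n⇒∣m+n)
open import Data.Nat.ListAction using () renaming (sum to listSum)
open import Data.Nat.Properties
open import Data.Product using (Σ; _×_; _,_; proj₁; proj₂)
open import Data.Sum using (_⊎_; inj₁; inj₂; swap)
open import Data.Vec.Functional using (foldr)
open import Function using (id; _∘_)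
open import Relation.Binary.PropositionalEquality
open import Relation.Nullary.Decidable
  using (Dec; yes; no; does; True; toWitness; from-yes; dec-true; _→-dec_; _⊎-dec_; _×-dec_)

open import Defs
open import Algebra.Properties.Semiring.Sum +-*-semiring
  using (sum-syntax; sum-cong-≗; sum-replicate-zero; ∑-distrib-+; ∑-comm; *-distribʳ-sum)

private
  variable
    n : ℕ

𝟙 : Bool → ℕ
𝟙 true  = 1
𝟙 false = 0

𝟙-∧ : ∀ x y → 𝟙 (x ∧ y) ≡ 𝟙 x * 𝟙 y
𝟙-∧ true  y = sym (+-identityʳ (𝟙 y))
𝟙-∧ false y = refl

∑-indicator : (x : Fin n) → ∑[ c < n ] 𝟙 (does (c ≟ᶠ x)) ≡ 1
∑-indicator {suc n} zero    = cong suc (sum-replicate-zero n)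
∑-indicator {suc n} (suc x) = ∑-indicator {n} x

count-tabulate : ∀ {m} k (f : Fin k → Fin m) (p : Fin m → Bool) →
  length (filter (λ i → T? (p i)) (tabulate f)) ≡ ∑[ i < k ] 𝟙 (p (f i))
count-tabulate zero    f p = refl
count-tabulate (suc k) f p with p (f zero)
... | true  = cong suc (count-tabulate k (f ∘ suc) p)
... | false = count-tabulate k (f ∘ suc) p

listSum-tabulate : ∀ k (g : Fin k → ℕ) → listSum (tabulate g) ≡ ∑[ i < k ] g i
listSum-tabulate zero    g = refl
listSum-tabulate (suc k) g = cong (g zero +_) (listSum-tabulate k (g ∘ suc))

countFin≡∑ : ∀ n (p : Fin n → Bool) → countFin n p ≡ ∑[ i < n ] 𝟙 (p i)
countFin≡∑ n p = count-tabulate n id p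

degree≡∑ : (G : Graph n) (v : Fin n) → degree G v ≡ ∑[ j < n ] 𝟙 (adj G v j)
degree≡∑ {n} G v = countFin≡∑ n (adj G v)

∑∑ : (Fin n → Fin n → ℕ) → ℕ
∑∑ {n} f = ∑[ i < n ] ∑[ j < n ] f i j

∑∑-cong : {f g : Fin n → Fin n → ℕ} → (∀ i j → f i j ≡ g i j) → ∑∑ f ≡ ∑∑ g
∑∑-cong f≡g = sum-cong-≗ (λ i → sum-cong-≗ (f≡g i))

∑∑-distrib-+ : (f g : Fin n → Fin n → ℕ) →
  ∑∑ (λ i j → f i j + g i j) ≡ ∑∑ f + ∑∑ g
∑∑-distrib-+ {n} f g =
  trans (sum-cong-≗ (λ i → ∑-distrib-+ (f i) (g i)))
        (∑-distrib-+ (λ i → ∑[ j < n ] f i j) (λ i → ∑[ j < n ] g i j))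

numEdges≡∑ : (G : Graph n) →
  numEdges G ≡ ∑∑ (λ i j → 𝟙 ((toℕ i <ᵇ toℕ j) ∧ adj G i j))
numEdges≡∑ {n} G = begin
  listSum (map row (tabulate id)) ≡⟨ cong listSum (map-tabulate id row) ⟩
  listSum (tabulate row)          ≡⟨ listSum-tabulate n row ⟩
  ∑[ i < n ] row i                ≡⟨ sum-cong-≗ (λ i → countFin≡∑ n (λ j → (toℕ i <ᵇ toℕ j) ∧ adj G i j)) ⟩
  ∑∑ (λ i j → 𝟙 ((toℕ i <ᵇ toℕ j) ∧ adj G i j)) ∎
  where
  open ≡-Reasoning
  row : Fin n → ℕ
  row i = countFin n (λ j → (toℕ i <ᵇ toℕ j) ∧ adj G i j)

<ᵇ-exactlyOne : ∀ x y → x ≢ y → 𝟙 (x <ᵇ y) + 𝟙 (y <ᵇ x) ≡ 1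
<ᵇ-exactlyOne zero    zero    x≢y = ⊥-elim (x≢y refl)
<ᵇ-exactlyOne zero    (suc y) _   = refl
<ᵇ-exactlyOne (suc x) zero    _   = refl
<ᵇ-exactlyOne (suc x) (suc y) x≢y = <ᵇ-exactlyOne x y (x≢y ∘ cong suc)

module Handshake (G : Graph n) where

  forward : Fin n → Fin n → ℕ
  forward i j = 𝟙 (toℕ i <ᵇ toℕ j) * 𝟙 (adj G i j)

  orient : ∀ i j → forward i j + forward j i ≡ 𝟙 (adj G i j)
  orient i j with i ≟ᶠ j
  ... | yes refl rewrite irrefl G i = cong₂ _+_ (*-zeroʳ (𝟙 (toℕ i <ᵇ toℕ i))) (*-zeroʳ (𝟙 (toℕ i <ᵇ toℕ i)))
  ... | no i≢j rewrite symm G j i = begin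
    lt * a + gt * a ≡⟨ *-distribʳ-+ a lt gt ⟨
    (lt + gt) * a   ≡⟨ cong (_* a) (<ᵇ-exactlyOne (toℕ i) (toℕ j) (i≢j ∘ toℕ-injective)) ⟩
    1 * a           ≡⟨ *-identityˡ a ⟩
    a               ∎
    where
    open ≡-Reasoning
    lt gt a : ℕ
    lt = 𝟙 (toℕ i <ᵇ toℕ j)
    gt = 𝟙 (toℕ j <ᵇ toℕ i)
    a  = 𝟙 (adj G i j)

  weighted-handshake : (e : Fin n → ℕ) →
    ∑∑ (λ i j → forward i j * (e i + e j)) ≡ ∑[ i < n ] (degree G i * e i)
  weighted-handshake e = begin
    ∑∑ (λ i j → forward i j * (e i + e j))
      ≡⟨ ∑∑-cong (λ i j → *-distribˡ-+ (forward i j) (e i) (e j)) ⟩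
    ∑∑ (λ i j → forward i j * e i + forward i j * e j)
      ≡⟨ ∑∑-distrib-+ (λ i j → forward i j * e i) (λ i j → forward i j * e j) ⟩
    ∑∑ (λ i j → forward i j * e i) + ∑∑ (λ i j → forward i j * e j)
      ≡⟨ cong (∑∑ (λ i j → forward i j * e i) +_) (∑-comm (λ i j → forward i j * e j)) ⟩
    ∑∑ (λ i j → forward i j * e i) + ∑∑ (λ i j → forward j i * e i)
      ≡⟨ ∑∑-distrib-+ (λ i j → forward i j * e i) (λ i j → forward j i * e i) ⟨
    ∑∑ (λ i j → forward i j * e i + forward j i * e i)
      ≡⟨ ∑∑-cong (λ i j → trans (sym (*-distribʳ-+ (e i) (forward i j) (forward j i))) (cong (_* e i) (orient i j))) ⟩
    ∑∑ (λ i j → 𝟙 (adj G i j) * e i)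
      ≡⟨ sum-cong-≗ (λ i → *-distribʳ-sum (e i) (λ j → 𝟙 (adj G i j))) ⟨
    ∑[ i < n ] (∑[ j < n ] 𝟙 (adj G i j) * e i)
      ≡⟨ sum-cong-≗ (λ i → cong (_* e i) (degree≡∑ G i)) ⟨
    ∑[ i < n ] (degree G i * e i) ∎
    where open ≡-Reasoning

  numEdges≡∑forward : numEdges G ≡ ∑∑ forward
  numEdges≡∑forward = trans (numEdges≡∑ G) (∑∑-cong λ i j → 𝟙-∧ (toℕ i <ᵇ toℕ j) (adj G i j))

DifferByOne : ℕ → ℕ → Set
DifferByOne d d′ = d ≡ suc d′ ⊎ d′ ≡ suc d

evenBit : ℕ → ℕ
evenBit zero          = 1
evenBit (suc zero)    = 0
evenBit (suc (suc d)) = evenBit d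

evenBit-suc : ∀ d → evenBit d + evenBit (suc d) ≡ 1
evenBit-suc zero          = refl
evenBit-suc (suc zero)    = refl
evenBit-suc (suc (suc d)) = evenBit-suc d

evenBit-differ : ∀ {d d′} → DifferByOne d d′ → evenBit d + evenBit d′ ≡ 1
evenBit-differ {d′ = d′} (inj₁ refl) = trans (+-comm (evenBit (suc d′)) _) (evenBit-suc d′)
evenBit-differ {d = d}   (inj₂ refl) = evenBit-suc d

-- d · evenBit d is d or 0 according to the parity of d, hence even.
2∣evenPart : ∀ d → 2 ∣ d * evenBit d
2∣evenPart zero          = 2 ∣0
2∣evenPart (suc zero)    = 2 ∣0
2∣evenPart (suc (suc d)) =
  subst (2 ∣_) (sym (*-distribʳ-+ (evenBit d) 2 d))
        (∣m∣n⇒∣m+n (divides (evenBit d) (*-comm 2 (evenBit d))) (2∣evenPart d))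

∣-∑ : ∀ {d} (f : Fin n → ℕ) → (∀ i → d ∣ f i) → d ∣ ∑[ i < n ] f i
∣-∑ {zero}  f d∣f = _ ∣0
∣-∑ {suc n} f d∣f = ∣m∣n⇒∣m+n (d∣f zero) (∣-∑ (f ∘ suc) (d∣f ∘ suc))

-- An SI graph has an even number of edges: each edge has exactly one endpoint
-- of even degree, so  m = Σ_i deg(i) · evenBit(deg i)  by the weighted handshake.
SI⇒even-edges : (G : Graph n) → StepwiseIrregular G → 2 ∣ numEdges G
SI⇒even-edges {n} G si =
  subst (2 ∣_) (sym edges≡) (∣-∑ (λ i → degree G i * e i) (λ i → 2∣evenPart (degree G i)))
  where
  open Handshake G
  e : Fin n → ℕ
  e = evenBit ∘ degree G
  oneEvenEnd : ∀ i j → 𝟙 (adj G i j) * (e i + e j) ≡ 𝟙 (adj G i j)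
  oneEvenEnd i j with adj G i j in ij
  ... | false = refl
  ... | true  = trans (+-identityʳ (e i + e j)) (evenBit-differ (si i j ij))
  edges≡ : numEdges G ≡ ∑[ i < n ] (degree G i * e i)
  edges≡ = begin
    numEdges G                             ≡⟨ numEdges≡∑forward ⟩
    ∑∑ forward                             ≡⟨ ∑∑-cong (λ i j → weigh i j) ⟨
    ∑∑ (λ i j → forward i j * (e i + e j)) ≡⟨ weighted-handshake e ⟩
    ∑[ i < n ] (degree G i * e i)          ∎
    where
    open ≡-Reasoning
    weigh : ∀ i j → forward i j * (e i + e j) ≡ forward i j
    weigh i j = trans (*-assoc (𝟙 (toℕ i <ᵇ toℕ j)) (𝟙 (adj G i j)) (e i + e j))
                      (cong (𝟙 (toℕ i <ᵇ toℕ j) *_) (oneEvenEnd i j))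

even-edges⇒odd-order : ∀ {m} → 2 ∣ m → m + 1 ≡ n + 2 → Odd n
even-edges⇒odd-order {n} (divides zero refl) eq =
  ⊥-elim (0≢1+n (suc-injective (trans eq (+-comm n 2))))
even-edges⇒odd-order {n} (divides (suc k) refl) eq =
  k , trans (sym k*2+1≡n) (trans (+-comm (k * 2) 1) (cong suc (*-comm k 2)))
  where
  k*2+1≡n : k * 2 + 1 ≡ n
  k*2+1≡n = suc-injective (suc-injective (trans eq (+-comm n 2)))

SI-bicyclic⇒odd-order : (G : Graph n) → StepwiseIrregular G → Bicyclic G → Odd n
SI-bicyclic⇒odd-order G si bic = even-edges⇒odd-order (SI⇒even-edges G si) bic

module _ {G : Graph n} where

  infixr 5 _++ʷ_

  _++ʷ_ : ∀ {u v w} → Walk G u v → Walk G v w → Walk G u w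
  here     ++ʷ q = q
  step e p ++ʷ q = step e (p ++ʷ q)

  reverseʷ : ∀ {u v} → Walk G u v → Walk G v u
  reverseʷ here               = here
  reverseʷ (step {u} {w} e p) = reverseʷ p ++ʷ step (trans (symm G w u) e) here

connected-via : (G : Graph n) (r : Fin n) → (∀ u → Walk G u r) → Connected G
connected-via G r toRoot u v = toRoot u ++ʷ reverseʷ (toRoot v)

searchWalk : (G : Graph n) (r : Fin n) → ℕ → (u : Fin n) → Maybe (Walk G u r)
searchWalk G r k u with u ≟ᶠ r
... | yes refl = just here
searchWalk G r zero    u | no _ = nothing
searchWalk G r (suc k) u | no _ = foldr _<∣>_ nothing through
  where
  through : ∀ w → Maybe (Walk G u r)
  through w with adj G u w in uw
  ... | true  = Maybe.map (step uw) (searchWalk G r k w)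
  ... | false = nothing

allJust : {B : Fin n → Set} → (∀ i → Maybe (B i)) → Maybe (∀ i → B i)
allJust {zero}  f = just λ ()
allJust {suc n} f with f zero | allJust (f ∘ suc)
... | just b | just bs = just λ { zero → b ; (suc i) → bs i }
... | _      | _       = nothing

listed : ∀ {k} → List (ℕ × ℕ) → Fin k → Fin k → Bool
listed es i j = any (λ { (x , y) → (toℕ i ≡ᵇ x) ∧ (toℕ j ≡ᵇ y) }) es

linked : ∀ {k} → List (ℕ × ℕ) → Fin k → Fin k → Bool
linked es i j = listed es i j ∨ listed es j i

Loopless? : ∀ k (es : List (ℕ × ℕ)) → Dec (∀ i → linked {k} es i i ≡ false)
Loopless? k es = all? (λ i → linked es i i ≟ᵇ false)

fromEdges : ∀ k (es : List (ℕ × ℕ)) → {True (Loopless? k es)} → Graph k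
fromEdges k es {loopless} = record
  { adj    = linked es
  ; symm   = λ i j → ∨-comm (listed es i j) (listed es j i)
  ; irrefl = toWitness loopless
  }

SI? : (G : Graph n) → Dec (StepwiseIrregular G)
SI? G = all? λ u → all? λ v → (adj G u v ≟ᵇ true) →-dec
  ((degree G u ≟ suc (degree G v)) ⊎-dec (degree G v ≟ suc (degree G u)))

GoodLeaf : (G : Graph n) → Fin n → Set
GoodLeaf G x = degree G x ≡ 1 × (∀ y → adj G x y ≡ true → degree G y ≡ 2)

GoodLeaf? : (G : Graph n) (x : Fin n) → Dec (GoodLeaf G x)
GoodLeaf? G x = (degree G x ≟ 1) ×-dec all? λ y → (adj G x y ≟ᵇ true) →-dec (degree G y ≟ 2)

does-≟ : ∀ (c x : Fin n) → does (c ≟ᶠ x) ≡ true → c ≡ x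
does-≟ c x with c ≟ᶠ x
... | yes c≡x = λ _ → c≡x
... | no  _   = λ ()

-- G with a new vertex, numbered 0, joined to the old vertex x (now suc x).
addLeaf : Graph n → Fin n → Graph (suc n)
addLeaf {n} G x = record { adj = A ; symm = A-symm ; irrefl = A-irrefl }
  where
  A : Fin (suc n) → Fin (suc n) → Bool
  A zero    zero    = false
  A zero    (suc c) = does (c ≟ᶠ x)
  A (suc a) zero    = does (a ≟ᶠ x)
  A (suc a) (suc c) = adj G a c
  A-symm : ∀ i j → A i j ≡ A j i
  A-symm zero    zero    = refl
  A-symm zero    (suc c) = refl
  A-symm (suc a) zero    = refl
  A-symm (suc a) (suc c) = symm G a c
  A-irrefl : ∀ i → A i i ≡ false
  A-irrefl zero    = refl
  A-irrefl (suc a) = irrefl G a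

module _ (G : Graph n) (x : Fin n) where

  addLeaf-degree-new : degree (addLeaf G x) zero ≡ 1
  addLeaf-degree-new = trans (degree≡∑ (addLeaf G x) zero) (∑-indicator x)

  addLeaf-degree-old : ∀ a → degree (addLeaf G x) (suc a) ≡ 𝟙 (does (a ≟ᶠ x)) + degree G a
  addLeaf-degree-old a =
    trans (degree≡∑ (addLeaf G x) (suc a)) (cong (𝟙 (does (a ≟ᶠ x)) +_) (sym (degree≡∑ G a)))

  -- The new vertex is numbered first, so the only new pair (i < j) is (new, x).
  addLeaf-numEdges : numEdges (addLeaf G x) ≡ suc (numEdges G)
  addLeaf-numEdges = trans (numEdges≡∑ (addLeaf G x)) (cong₂ _+_ (∑-indicator x) (sym (numEdges≡∑ G)))

  addLeaf-bicyclic : Bicyclic G → Bicyclic (addLeaf G x)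
  addLeaf-bicyclic bic = trans (cong (_+ 1) addLeaf-numEdges) (cong suc bic)

  lift : ∀ {a c} → Walk G a c → Walk (addLeaf G x) (suc a) (suc c)
  lift here       = here
  lift (step e p) = step e (lift p)

  addLeaf-connected : Connected G → Connected (addLeaf G x)
  addLeaf-connected conn = connected-via (addLeaf G x) (suc x) toX
    where
    toX : ∀ u → Walk (addLeaf G x) u (suc x)
    toX zero    = step (dec-true (x ≟ᶠ x) refl) here
    toX (suc a) = lift (conn a x)

-- Vertex labels f that differ by one along every edge; SI means Compatible G (degree G).
Compatible : Graph n → (Fin n → ℕ) → Set
Compatible G f = ∀ u v → adj G u v ≡ true → DifferByOne (f u) (f v)

Compatible-cong : ∀ {G : Graph n} {f g} → (∀ a → f a ≡ g a) → Compatible G f → Compatible G g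
Compatible-cong f≡g comp u v e = subst₂ DifferByOne (f≡g u) (f≡g v) (comp u v e)

addLeaf-compatible : ∀ {G : Graph n} {x} (f : Fin (suc n) → ℕ) →
  Compatible G (f ∘ suc) → DifferByOne (f zero) (f (suc x)) → Compatible (addLeaf G x) f
addLeaf-compatible         f old new zero    zero    ()
addLeaf-compatible {x = x} f old new zero    (suc c) e with refl ← does-≟ c x e = new
addLeaf-compatible {x = x} f old new (suc a) zero    e with refl ← does-≟ a x e = swap new
addLeaf-compatible         f old new (suc a) (suc c) e = old a c e

-- G with a new path x – r – ℓ; ℓ is vertex 0, r is vertex 1, old a is suc (suc a).
addPendantPath : Graph n → Fin n → Graph (2 + n)
addPendantPath G x = addLeaf (addLeaf G x) zero

module _ (G : Graph n) (x : Fin n) where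

  private
    P = addPendantPath G x
    ℓ r : Fin (2 + n)
    ℓ = zero
    r = suc zero

  pendant-degree-ℓ : degree P ℓ ≡ 1
  pendant-degree-ℓ = addLeaf-degree-new (addLeaf G x) zero

  pendant-degree-r : degree P r ≡ 2
  pendant-degree-r = trans (addLeaf-degree-old (addLeaf G x) zero zero)
                           (cong suc (addLeaf-degree-new G x))

  pendant-degree-old : ∀ a → degree P (suc (suc a)) ≡ 𝟙 (does (a ≟ᶠ x)) + degree G a
  pendant-degree-old a = trans (addLeaf-degree-old (addLeaf G x) zero (suc a))
                               (addLeaf-degree-old G x a)

  pendant-goodLeaf : GoodLeaf P ℓ
  pendant-goodLeaf = pendant-degree-ℓ , neighbour
    where
    neighbour : ∀ y → adj P ℓ y ≡ true → degree P y ≡ 2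
    neighbour (suc p) e with refl ← does-≟ p zero e = pendant-degree-r

  pendant-bicyclic : Bicyclic G → Bicyclic P
  pendant-bicyclic = addLeaf-bicyclic (addLeaf G x) zero ∘ addLeaf-bicyclic G x

  pendant-connected : Connected G → Connected P
  pendant-connected = addLeaf-connected (addLeaf G x) zero ∘ addLeaf-connected G x

  pendant-compatible : (f : Fin (2 + n) → ℕ) → Compatible G (λ a → f (suc (suc a))) →
    DifferByOne (f ℓ) (f r) → DifferByOne (f r) (f (suc (suc x))) → Compatible P f
  pendant-compatible f old ℓr rx =
    addLeaf-compatible f (addLeaf-compatible (f ∘ suc) old rx) ℓr

record PendantRealisation (n : ℕ) : Set where
  field
    graph     : Graph n
    connected : Connected graph
    stepwise  : StepwiseIrregular graph
    bicyclic  : Bicyclic graph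
    leaf      : Fin n
    goodLeaf  : GoodLeaf graph leaf

rises : ∀ {d d′ k} → d ≡ k → d′ ≡ suc k → DifferByOne d d′
rises d≡k d′≡1+k = inj₂ (trans d′≡1+k (cong suc (sym d≡k)))

-- Hang two pendant paths of length two at the good leaf x: x gets degree 3,
-- its old neighbour keeps degree 2, and the end of a new path is a good leaf.
grow : PendantRealisation n → PendantRealisation (4 + n)
grow {n} R = record
  { graph     = H
  ; connected = pendant-connected P x₂ (pendant-connected G x connected)
  ; stepwise  = pendant-compatible P x₂ (degree H)
                  (pendant-compatible G x (λ a → degree H (suc (suc a)))
                    (Compatible-cong {G = G} (λ a → sym (degree-old a)) old-compatible)
                    (rises degree-ℓ₁ degree-r₁) (rises degree-r₁ degree-x))
                  (rises (pendant-degree-ℓ P x₂) (pendant-degree-r P x₂))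
                  (rises (pendant-degree-r P x₂) degree-x)
  ; bicyclic  = pendant-bicyclic P x₂ (pendant-bicyclic G x bicyclic)
  ; leaf      = zero
  ; goodLeaf  = pendant-goodLeaf P x₂
  }
  where
  open PendantRealisation R renaming (graph to G; leaf to x)
  P : Graph (2 + n)
  P = addPendantPath G x
  x₂ : Fin (2 + n)
  x₂ = suc (suc x)
  H : Graph (4 + n)
  H = addPendantPath P x₂

  bump : Fin n → ℕ
  bump a = 𝟙 (does (a ≟ᶠ x))

  degree-old : ∀ a → degree H (suc (suc (suc (suc a)))) ≡ bump a + (bump a + degree G a)
  degree-old a = trans (pendant-degree-old P x₂ (suc (suc a)))
                       (cong (bump a +_) (pendant-degree-old G x a))

  degree-x : degree H (suc (suc x₂)) ≡ 3
  degree-x = trans (degree-old x)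
    (cong₂ (λ t d → 𝟙 t + (𝟙 t + d)) (dec-true (x ≟ᶠ x) refl) (proj₁ goodLeaf))

  degree-ℓ₁ : degree H (suc (suc zero)) ≡ 1
  degree-ℓ₁ = trans (pendant-degree-old P x₂ zero) (pendant-degree-ℓ G x)

  degree-r₁ : degree H (suc (suc (suc zero))) ≡ 2
  degree-r₁ = trans (pendant-degree-old P x₂ (suc zero)) (pendant-degree-r G x)

  old-compatible : Compatible G (λ a → bump a + (bump a + degree G a))
  old-compatible a c e with a ≟ᶠ x | c ≟ᶠ x
  ... | yes refl | yes refl = ⊥-elim (true≢false (trans (sym e) (irrefl G a)))
    where
    true≢false : true ≢ false
    true≢false ()
  ... | yes refl | no _ = inj₁ (trans (cong (2 +_) (proj₁ goodLeaf)) (cong suc (sym (proj₂ goodLeaf c e))))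
  ... | no _ | yes refl = inj₂ (trans (cong (2 +_) (proj₁ goodLeaf))
                                      (cong suc (sym (proj₂ goodLeaf a (trans (symm G c a) e)))))
  ... | no _ | no _ = stepwise a c e

SIBicyclic : ℕ → Set
SIBicyclic n = Σ (Graph n) λ G → Connected G × StepwiseIrregular G × Bicyclic G

K₂₃ : Graph 5
K₂₃ = fromEdges 5 ((0 , 2) ∷ (0 , 3) ∷ (0 , 4) ∷ (1 , 2) ∷ (1 , 3) ∷ (1 , 4) ∷ [])

order5 : SIBicyclic 5
order5 = K₂₃ , connected-via K₂₃ (# 0) (from-just (allJust (searchWalk K₂₃ (# 0) 2)))
             , from-yes (SI? K₂₃) , refl

-- K₂,₃ with the edge 0–2 subdivided twice (0–5–6–2) and a path 6–7–8 hung at 6.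
order9 : PendantRealisation 9
order9 = record
  { graph     = G
  ; connected = connected-via G (# 0) (from-just (allJust (searchWalk G (# 0) 4)))
  ; stepwise  = from-yes (SI? G)
  ; bicyclic  = refl
  ; leaf      = # 8
  ; goodLeaf  = from-yes (GoodLeaf? G (# 8))
  }
  where
  G : Graph 9
  G = fromEdges 9 ((0 , 3) ∷ (0 , 4) ∷ (1 , 2) ∷ (1 , 3) ∷ (1 , 4) ∷
                   (0 , 5) ∷ (5 , 6) ∷ (6 , 2) ∷ (6 , 7) ∷ (7 , 8) ∷ [])

-- Two 4-cycles 0–1–2–3 and 0–4–5–6 sharing 0, with paths of length two hung at 1, 3, 4, 6.
order15 : PendantRealisation 15
order15 = record
  { graph     = G
  ; connected = connected-via G (# 0) (from-just (allJust (searchWalk G (# 0) 3)))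
  ; stepwise  = from-yes (SI? G)
  ; bicyclic  = refl
  ; leaf      = # 8
  ; goodLeaf  = from-yes (GoodLeaf? G (# 8))
  }
  where
  G : Graph 15
  G = fromEdges 15 ((0 , 1) ∷ (1 , 2) ∷ (2 , 3) ∷ (3 , 0) ∷ (0 , 4) ∷ (4 , 5) ∷ (5 , 6) ∷ (6 , 0) ∷
                    (1 , 7) ∷ (7 , 8) ∷ (3 , 9) ∷ (9 , 10) ∷ (4 , 11) ∷ (11 , 12) ∷ (6 , 13) ∷ (13 , 14) ∷ [])

forget : PendantRealisation n → SIBicyclic n
forget R = graph , connected , stepwise , bicyclic
  where open PendantRealisation R

pendantRealisation : ∀ k → k ≢ 1 → PendantRealisation (suc (2 * (4 + k)))
pendantRealisation 0 _ = order9
pendantRealisation 1 k≢1 = ⊥-elim (k≢1 refl)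
pendantRealisation 2 _ = grow order9
pendantRealisation 3 _ = order15
pendantRealisation (suc (suc (suc (suc k)))) _ =
  subst PendantRealisation (sym (twoMore (6 + k))) (grow (pendantRealisation (suc (suc k)) (λ ())))
  where
  twoMore : ∀ m → suc (2 * (2 + m)) ≡ 4 + suc (2 * m)
  twoMore m = cong suc (*-distribˡ-+ 2 2 m)

realise : ∀ n → Odd n → n ≢ 1 → n ≢ 3 → n ≢ 7 → n ≢ 11 → SIBicyclic n
realise _ (0 , refl) ≢1 _  _  _   = ⊥-elim (≢1 refl)
realise _ (1 , refl) _  ≢3 _  _   = ⊥-elim (≢3 refl)
realise _ (2 , refl) _  _  _  _   = order5
realise _ (3 , refl) _  _  ≢7 _   = ⊥-elim (≢7 refl)
realise _ (suc (suc (suc (suc k))) , refl) _ _ _ ≢11 =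
  forget (pendantRealisation k λ { refl → ≢11 refl })

mainTheorem3 : ((n : ℕ) (G : Graph n) → Connected G → StepwiseIrregular G → Bicyclic G → Odd n)
    × ((n : ℕ) → Odd n → n ≢ 1 → n ≢ 3 → n ≢ 7 → n ≢ 11 →
    Σ (Graph n) λ G → Connected G × StepwiseIrregular G × Bicyclic G)
mainTheorem3 = (λ n G _ → SI-bicyclic⇒odd-order G) , realise
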